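{- Let $k\ge 4$ be an integer. If the cycle $C_n$ admits a 1-paired $k$-NL-coloring, then the path $P_n$ admits a $k$-NL-coloring.
   Context: A $k$-coloring of a graph $G$ is a partition of $V(G)$ into $k$ independent sets (colors). A coloring $\{S_1,\dots,S_k\}$ is neighbor-locating (a $k$-NL-coloring) if for any two distinct vertices $u,v$ in the same color class, $\{j: N(u)\cap S_j\neq\emptyset\}\neq\{j: N(v)\cap S_j\neq\emptyset\}$. The color-degree of a vertex $v$ is $|\{j: N(v)\cap S_j\neq\emptyset\}|$. An NL-coloring is 1-paired if every vertex of color-degree $1$ has a neighbor of color-degree $1$. -}

module Defs where

open import Data.Nat using (ℕ; suc; pred; _%_; _≥_)
open import Data.Fin using (Fin; toℕ)
open import Data.Product using (Σ; ∃; _×_)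
open import Data.Sum using (_⊎_)
open import Relation.Nullary using (¬_)
open import Relation.Binary.PropositionalEquality using (_≡_)
open import Function.Bundles using (_⇔_)
open import Level using (0ℓ)

-- A graph on vertex set Fin n is given by its (symmetric, irreflexive) adjacency relation.
Graph : ℕ → Set₁
Graph n = Fin n → Fin n → Set

PathAdj : (n : ℕ) → Fin n → Fin n → Set
PathAdj n u v = (toℕ v ≡ suc (toℕ u)) ⊎ (toℕ u ≡ suc (toℕ v))

-- Cycle C_n : vertices 0,…,n-1, i ~ i+1 (mod n). (Only a simple graph for n ≥ 3.)
succMod : (n : ℕ) → ℕ → ℕ
succMod n i = suc i % suc (pred n)

CycleAdj : (n : ℕ) → Fin n → Fin n → Set
CycleAdj n u v = (toℕ v ≡ succMod n (toℕ u)) ⊎ (toℕ u ≡ succMod n (toℕ v))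

-- A k-coloring: a map to Fin k that is onto (k nonempty color classes)
-- and whose classes are independent sets.
IsColoring : ∀ {n} (G : Graph n) (k : ℕ) → (Fin n → Fin k) → Set
IsColoring G k c =
  (∀ j → ∃ λ v → c v ≡ j) × (∀ u v → G u v → ¬ (c u ≡ c v))

NbrColor : ∀ {n k} (G : Graph n) → (Fin n → Fin k) → Fin n → Fin k → Set
NbrColor G c v j = ∃ λ w → G v w × (c w ≡ j)

IsNeighborLocating : ∀ {n k} (G : Graph n) → (Fin n → Fin k) → Set
IsNeighborLocating {n} {k} G c =
  ∀ u v → ¬ (u ≡ v) → c u ≡ c v →
    ¬ (∀ (j : Fin k) → NbrColor G c u j ⇔ NbrColor G c v j)

IsNLColoring : ∀ {n} (G : Graph n) (k : ℕ) → (Fin n → Fin k) → Set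
IsNLColoring G k c = IsColoring G k c × IsNeighborLocating G c

ColorDegreeOne : ∀ {n k} (G : Graph n) → (Fin n → Fin k) → Fin n → Set
ColorDegreeOne {n} {k} G c v = ∃ λ (j : Fin k) → ∀ j' → NbrColor G c v j' ⇔ (j' ≡ j)

IsOnePaired : ∀ {n k} (G : Graph n) → (Fin n → Fin k) → Set
IsOnePaired G c =
  ∀ v → ColorDegreeOne G c v → ∃ λ w → G v w × ColorDegreeOne G c w

module Submission where

-- A path P_n is the cycle C_n with one edge deleted, so a
-- k-NL-colouring of C_n restricts to a proper k-colouring of P_n; the only
-- question is whether the two end vertices still see the same colour sets.
--   * If C_n has no vertex of colour-degree 1, cut C_n anywhere: interior
--     vertices see the same colours as before, the ends have colour-degree 1
--     in P_n and so cannot be confused with any interior vertex (that vertex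
--     would have colour-degree 1 in C_n), and the two ends are adjacent in
--     C_n, hence differently coloured.
--   * Otherwise 1-pairedness gives two adjacent vertices x, next x of
--     colour-degree 1; cutting the edge between them loses no colour at
--     either end, so every vertex keeps its colour set.

open import Defs
open import Data.Nat using (ℕ; _≥_)
open import Data.Fin using (Fin)
open import Data.Product using (Σ; ∃; _×_)

open import Data.Nat using (suc; _+_; _∸_; _%_; _<_; s≤s; z≤n; s≤s⁻¹; NonZero)
import Data.Nat.Properties as ℕ
open import Data.Nat.DivMod using (m%n<n; %-distribˡ-+; m%n%n≡m%n; [m+n]%n≡m%n; m<n⇒m%n≡m; n%n≡0)
open import Data.Fin as Fin using (toℕ; fromℕ; fromℕ<)
open import Data.Fin.Properties using (toℕ-fromℕ<; toℕ-fromℕ; toℕ-injective; toℕ<n; any?)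
open import Data.Product using (_,_)
open import Data.Sum using (_⊎_; inj₁; inj₂)
open import Data.Empty using (⊥-elim)
open import Function using (_∘_)
open import Function.Bundles using (_⇔_; mk⇔; Equivalence)
import Function.Properties.Equivalence as ⇔
open import Relation.Nullary using (¬_; Dec; yes; no)
open import Relation.Nullary.Decidable using (map′)
open import Relation.Binary.PropositionalEquality
open Equivalence using (to; from)

colorDegreeOne-resp : ∀ {n n′ k} (G : Graph n) (c : Fin n → Fin k) (u : Fin n)
  (G′ : Graph n′) (c′ : Fin n′ → Fin k) (v : Fin n′) →
  (∀ j → NbrColor G c u j ⇔ NbrColor G′ c′ v j) →
  ColorDegreeOne G′ c′ v → ColorDegreeOne G c u
colorDegreeOne-resp _ _ _ _ _ _ same (j , single) = j , λ j′ → ⇔.trans (same j′) (single j′)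

record Automorphism {n} (G : Graph n) : Set where
  field
    σ σ⁻¹   : Fin n → Fin n
    σσ⁻¹    : ∀ v → σ (σ⁻¹ v) ≡ v
    σ⁻¹σ    : ∀ v → σ⁻¹ (σ v) ≡ v
    σ-adj   : ∀ {u v} → G u v → G (σ u) (σ v)
    σ⁻¹-adj : ∀ {u v} → G u v → G (σ⁻¹ u) (σ⁻¹ v)

module _ {n k} {G : Graph n} (α : Automorphism G) (c : Fin n → Fin k) where
  open Automorphism α

  nbrColor-aut : ∀ v j → NbrColor G (c ∘ σ) v j ⇔ NbrColor G c (σ v) j
  nbrColor-aut v j = mk⇔
    (λ (w , adj , cw) → σ w , σ-adj adj , cw)
    (λ (w , adj , cw) → σ⁻¹ w
                      , subst (λ u → G u (σ⁻¹ w)) (σ⁻¹σ v) (σ⁻¹-adj adj)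
                      , trans (cong c (σσ⁻¹ w)) cw)

  colorDegreeOne-aut : ∀ v → ColorDegreeOne G c (σ v) → ColorDegreeOne G (c ∘ σ) v
  colorDegreeOne-aut v = colorDegreeOne-resp G (c ∘ σ) v G c (σ v) (nbrColor-aut v)

  nlColoring-aut : IsNLColoring G k c → IsNLColoring G k (c ∘ σ)
  nlColoring-aut ((onto , proper) , locating) =
      ((λ j → let (v , cv) = onto j in σ⁻¹ v , trans (cong c (σσ⁻¹ v)) cv)
      , λ u v adj → proper (σ u) (σ v) (σ-adj adj))
    , λ u v u≢v cu≡cv same → locating (σ u) (σ v) (σ-injective u≢v) cu≡cv
        λ j → ⇔.trans (⇔.sym (nbrColor-aut u j)) (⇔.trans (same j) (nbrColor-aut v j))
    where
    σ-injective : ∀ {u v} → ¬ u ≡ v → ¬ σ u ≡ σ v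
    σ-injective {u} {v} u≢v e = u≢v (trans (sym (σ⁻¹σ u)) (trans (cong σ⁻¹ e) (σ⁻¹σ v)))

SameNbrColors : ∀ {n k} (H G : Graph n) → (Fin n → Fin k) → Fin n → Set
SameNbrColors H G c v = ∀ j → NbrColor H c v j ⇔ NbrColor G c v j

module Subgraph {n} (H G : Graph n) (H⊆G : ∀ {u v} → H u v → G u v) {k} (c : Fin n → Fin k) where

  same-full : ∀ v → (∀ {w} → G v w → H v w) → SameNbrColors H G c v
  same-full v full j = mk⇔ (λ (w , adj , cw) → w , H⊆G adj , cw)
                           (λ (w , adj , cw) → w , full adj , cw)

  same-colorDegreeOne : ∀ v → ColorDegreeOne G c v → ∃ (H v) → SameNbrColors H G c v
  same-colorDegreeOne v (j₀ , single) (w , adj) j = mk⇔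
    (λ (w′ , adj′ , cw′) → w′ , H⊆G adj′ , cw′)
    (λ nbr → w , adj , trans (to (single (c w)) (w , H⊆G adj , refl))
                             (sym (to (single j) nbr)))

  locating-same : IsNeighborLocating G c → ∀ u v →
    SameNbrColors H G c u → SameNbrColors H G c v → ¬ u ≡ v → c u ≡ c v →
    ¬ (∀ j → NbrColor H c u j ⇔ NbrColor H c v j)
  locating-same locating u v same-u same-v u≢v cu≡cv same = locating u v u≢v cu≡cv
    λ j → ⇔.trans (⇔.sym (same-u j)) (⇔.trans (same j) (same-v j))

  nlColoring-sub : IsNLColoring G k c → (∀ v → SameNbrColors H G c v) → IsNLColoring H k c
  nlColoring-sub ((onto , proper) , locating) same =
    (onto , λ u v adj → proper u v (H⊆G adj))
    , λ u v → locating-same locating u v (same u) (same v)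

  nlColoring-sub-ends : IsNLColoring G k c → (∀ v → ¬ ColorDegreeOne G c v) →
    (End : Fin n → Set) → (∀ v → End v ⊎ SameNbrColors H G c v) →
    (∀ v → End v → ColorDegreeOne H c v) → (∀ u v → End u → End v → ¬ u ≡ v → G u v) →
    IsNLColoring H k c
  nlColoring-sub-ends ((onto , proper) , locating) no-cd1 End classify end-cd1 ends-adj =
    (onto , λ u v adj → proper u v (H⊆G adj)) , locating′
    where
    end-vs-same : ∀ u v → End u → SameNbrColors H G c v →
      ¬ (∀ j → NbrColor H c u j ⇔ NbrColor H c v j)
    end-vs-same u v end-u same-v same = no-cd1 v
      (colorDegreeOne-resp G c v H c u (λ j → ⇔.trans (⇔.sym (same-v j)) (⇔.sym (same j))) (end-cd1 u end-u))
    locating′ : IsNeighborLocating H c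
    locating′ u v u≢v cu≡cv with classify u | classify v
    ... | inj₁ end-u  | inj₁ end-v  = λ _ → proper u v (ends-adj u v end-u end-v u≢v) cu≡cv
    ... | inj₁ end-u  | inj₂ same-v = end-vs-same u v end-u same-v
    ... | inj₂ same-u | inj₁ end-v  = λ same → end-vs-same v u end-v same-u (⇔.sym ∘ same)
    ... | inj₂ same-u | inj₂ same-v = locating-same locating u v same-u same-v u≢v cu≡cv

%-absorbʳ : ∀ a b n .{{_ : NonZero n}} → (a + b % n) % n ≡ (a + b) % n
%-absorbʳ a b n = begin
  (a + b % n) % n           ≡⟨ %-distribˡ-+ a (b % n) n ⟩
  (a % n + b % n % n) % n   ≡⟨ cong (λ z → (a % n + z) % n) (m%n%n≡m%n b n) ⟩
  (a % n + b % n) % n       ≡⟨ %-distribˡ-+ a b n ⟨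
  (a + b) % n               ∎
  where open ≡-Reasoning

module Rotation (m : ℕ) where
  n : ℕ
  n = suc m

  rotate : ℕ → Fin n → Fin n
  rotate s i = fromℕ< (m%n<n (s + toℕ i) n)

  toℕ-rotate : ∀ s i → toℕ (rotate s i) ≡ (s + toℕ i) % n
  toℕ-rotate s i = toℕ-fromℕ< _

  rotate-∘ : ∀ a b i → rotate a (rotate b i) ≡ rotate (a + b) i
  rotate-∘ a b i = toℕ-injective (begin
    toℕ (rotate a (rotate b i)) ≡⟨ toℕ-rotate a _ ⟩
    (a + toℕ (rotate b i)) % n  ≡⟨ cong (λ z → (a + z) % n) (toℕ-rotate b i) ⟩
    (a + (b + toℕ i) % n) % n   ≡⟨ %-absorbʳ a (b + toℕ i) n ⟩
    (a + (b + toℕ i)) % n       ≡⟨ cong (_% n) (ℕ.+-assoc a b (toℕ i)) ⟨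
    (a + b + toℕ i) % n         ≡⟨ toℕ-rotate (a + b) i ⟨
    toℕ (rotate (a + b) i)      ∎)
    where open ≡-Reasoning

  rotate-full : ∀ i → rotate n i ≡ i
  rotate-full i = toℕ-injective (begin
    toℕ (rotate n i) ≡⟨ toℕ-rotate n i ⟩
    (n + toℕ i) % n  ≡⟨ cong (_% n) (ℕ.+-comm n (toℕ i)) ⟩
    (toℕ i + n) % n  ≡⟨ [m+n]%n≡m%n (toℕ i) n ⟩
    toℕ i % n        ≡⟨ m<n⇒m%n≡m (toℕ<n i) ⟩
    toℕ i            ∎)
    where open ≡-Reasoning

  rotate-inverse : ∀ a b → a + b ≡ n → ∀ i → rotate a (rotate b i) ≡ i
  rotate-inverse a b a+b≡n i =
    trans (rotate-∘ a b i) (trans (cong (λ s → rotate s i) a+b≡n) (rotate-full i))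

  rotate-comm : ∀ u v → rotate (toℕ u) v ≡ rotate (toℕ v) u
  rotate-comm u v = toℕ-injective (trans (toℕ-rotate (toℕ u) v)
    (trans (cong (_% n) (ℕ.+-comm (toℕ u) (toℕ v))) (sym (toℕ-rotate (toℕ v) u))))

  rotate-zero : ∀ u → rotate (toℕ u) Fin.zero ≡ u
  rotate-zero u = trans (rotate-comm u Fin.zero)
    (toℕ-injective (trans (toℕ-rotate 0 u) (m<n⇒m%n≡m (toℕ<n u))))

  next prev : Fin n → Fin n
  next = rotate 1
  prev = rotate m

  next-prev : ∀ i → next (prev i) ≡ i
  next-prev = rotate-inverse 1 m refl

  prev-next : ∀ i → prev (next i) ≡ i
  prev-next = rotate-inverse m 1 (ℕ.+-comm m 1)

  rotate-next : ∀ s i → rotate s (next i) ≡ next (rotate s i)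
  rotate-next s i = trans (rotate-∘ s 1 i)
    (trans (cong (λ t → rotate t i) (ℕ.+-comm s 1)) (sym (rotate-∘ 1 s i)))

module Cycle (m : ℕ) where
  open Rotation m public

  C : Graph n
  C = CycleAdj n

  cycleAdj-next : ∀ {u v} → v ≡ next u → C u v
  cycleAdj-next {u} refl = inj₁ (toℕ-rotate 1 u)

  cycleAdj-cases : ∀ {u v} → C u v → v ≡ next u ⊎ u ≡ next v
  cycleAdj-cases {u} {v} (inj₁ e) = inj₁ (toℕ-injective (trans e (sym (toℕ-rotate 1 u))))
  cycleAdj-cases {u} {v} (inj₂ e) = inj₂ (toℕ-injective (trans e (sym (toℕ-rotate 1 v))))

  cycleAdj-sym : ∀ {u v} → C u v → C v u
  cycleAdj-sym (inj₁ e) = inj₂ e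
  cycleAdj-sym (inj₂ e) = inj₁ e

  cycleAdj-prev : ∀ u → C u (prev u)
  cycleAdj-prev u = cycleAdj-sym (cycleAdj-next (sym (next-prev u)))

  cycle-neighbours : ∀ {u v} → C u v → v ≡ next u ⊎ v ≡ prev u
  cycle-neighbours adj with cycleAdj-cases adj
  ... | inj₁ e = inj₁ e
  ... | inj₂ e = inj₂ (trans (sym (prev-next _)) (cong prev (sym e)))

  -- Rotations commute with next, hence preserve adjacency.
  rotate-adj : ∀ s {u v} → C u v → C (rotate s u) (rotate s v)
  rotate-adj s adj with cycleAdj-cases adj
  ... | inj₁ refl = cycleAdj-next (rotate-next s _)
  ... | inj₂ refl = cycleAdj-sym (cycleAdj-next (rotate-next s _))

  rotation : Fin n → Automorphism C
  rotation r = record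
    { σ       = rotate (toℕ r)
    ; σ⁻¹     = rotate (n ∸ toℕ r)
    ; σσ⁻¹    = rotate-inverse (toℕ r) (n ∸ toℕ r) (ℕ.m+[n∸m]≡n r≤n)
    ; σ⁻¹σ    = rotate-inverse (n ∸ toℕ r) (toℕ r) (ℕ.m∸n+n≡m r≤n)
    ; σ-adj   = rotate-adj (toℕ r)
    ; σ⁻¹-adj = rotate-adj (n ∸ toℕ r)
    }
    where r≤n = ℕ.<⇒≤ (toℕ<n r)

  module _ {k} (c : Fin n → Fin k) where
    colorDegreeOne⇒ : ∀ x → ColorDegreeOne C c x → c (prev x) ≡ c (next x)
    colorDegreeOne⇒ x (j , single) =
      trans (to (single _) (prev x , cycleAdj-prev x , refl))
            (sym (to (single _) (next x , cycleAdj-next refl , refl)))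

    colorDegreeOne⇐ : ∀ x → c (prev x) ≡ c (next x) → ColorDegreeOne C c x
    colorDegreeOne⇐ x same = c (next x) , λ j → mk⇔
      (λ (y , adj , cy) → trans (sym cy) (neighbour-colour (cycle-neighbours adj)))
      (λ j≡ → next x , cycleAdj-next refl , sym j≡)
      where
      neighbour-colour : ∀ {y} → y ≡ next x ⊎ y ≡ prev x → c y ≡ c (next x)
      neighbour-colour (inj₁ refl) = refl
      neighbour-colour (inj₂ refl) = same

    colorDegreeOne? : ∀ x → Dec (ColorDegreeOne C c x)
    colorDegreeOne? x = map′ (colorDegreeOne⇐ x) (colorDegreeOne⇒ x) (c (prev x) Fin.≟ c (next x))

    paired-edge : IsOnePaired C c → ∀ a → ColorDegreeOne C c a →
      ∃ λ x → ColorDegreeOne C c x × ColorDegreeOne C c (next x)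
    paired-edge paired a cd-a with paired a cd-a
    ... | b , adj , cd-b with cycleAdj-cases adj
    ...   | inj₁ refl = a , cd-a , cd-b
    ...   | inj₂ refl = b , cd-b , cd-a

-- The path P_n is C_n minus the closing edge {last, zero}.

module Path (m : ℕ) where
  open Cycle m public

  P : Graph n
  P = PathAdj n

  last : Fin n
  last = fromℕ m

  IsEnd : Fin n → Set
  IsEnd v = v ≡ Fin.zero ⊎ v ≡ last

  next-last : next last ≡ Fin.zero
  next-last = toℕ-injective (trans (toℕ-rotate 1 last)
    (trans (cong (λ z → suc z % n) (toℕ-fromℕ m)) (n%n≡0 n)))

  toℕ-next : ∀ {u} → ¬ u ≡ last → toℕ (next u) ≡ suc (toℕ u)
  toℕ-next {u} u≢last = trans (toℕ-rotate 1 u) (m<n⇒m%n≡m (s≤s u<m))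
    where
    u<m : toℕ u < m
    u<m with ℕ.m≤n⇒m<n∨m≡n (s≤s⁻¹ (toℕ<n u))
    ... | inj₁ lt = lt
    ... | inj₂ eq = ⊥-elim (u≢last (toℕ-injective (trans eq (sym (toℕ-fromℕ m)))))

  pathAdj-next : ∀ {u} → ¬ u ≡ last → P u (next u)
  pathAdj-next u≢last = inj₁ (toℕ-next u≢last)

  pathAdj-prev : ∀ {u} → ¬ u ≡ Fin.zero → P u (prev u)
  pathAdj-prev {u} u≢0 = inj₂ (trans (cong toℕ (sym (next-prev u))) (toℕ-next prev≢last))
    where
    prev≢last : ¬ prev u ≡ last
    prev≢last e = u≢0 (trans (sym (next-prev u)) (trans (cong next e) next-last))

  path⊆cycle : ∀ {u v} → P u v → C u v
  path⊆cycle {u} {v} (inj₁ e) = cycleAdj-next (toℕ-injective (trans e (sym (toℕ-next u≢last))))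
    where
    u≢last : ¬ u ≡ last
    u≢last refl = ℕ.<-irrefl (cong suc (toℕ-fromℕ m)) (subst (_< n) e (toℕ<n v))
  path⊆cycle (inj₂ e) = cycleAdj-sym (path⊆cycle (inj₁ e))

  interior-full : ∀ u → ¬ IsEnd u → ∀ {v} → C u v → P u v
  interior-full u interior adj with cycle-neighbours adj
  ... | inj₁ refl = pathAdj-next (interior ∘ inj₂)
  ... | inj₂ refl = pathAdj-prev (interior ∘ inj₁)

  ends-adjacent : ∀ u v → IsEnd u → IsEnd v → ¬ u ≡ v → C u v
  ends-adjacent u v (inj₁ refl) (inj₁ refl) u≢v = ⊥-elim (u≢v refl)
  ends-adjacent u v (inj₂ refl) (inj₂ refl) u≢v = ⊥-elim (u≢v refl)
  ends-adjacent u v (inj₁ refl) (inj₂ refl) _   = cycleAdj-sym (cycleAdj-next (sym next-last))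
  ends-adjacent u v (inj₂ refl) (inj₁ refl) _   = cycleAdj-next (sym next-last)

  classify : ∀ v → IsEnd v ⊎ ¬ IsEnd v
  classify v with v Fin.≟ Fin.zero | v Fin.≟ last
  ... | yes e | _     = inj₁ (inj₁ e)
  ... | no _  | yes e = inj₁ (inj₂ e)
  ... | no a  | no b  = inj₂ λ { (inj₁ e) → a e ; (inj₂ e) → b e }

  path-neighbour : ¬ m ≡ 0 → ∀ v → ∃ (P v)
  path-neighbour m≢0 v with v Fin.≟ last
  ... | no v≢last = next v , pathAdj-next v≢last
  ... | yes refl  = prev last , pathAdj-prev λ e → m≢0 (trans (sym (toℕ-fromℕ m)) (cong toℕ e))

  zero-neighbour : ∀ {w} → P Fin.zero w → toℕ w ≡ 1
  zero-neighbour (inj₁ e) = e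
  zero-neighbour (inj₂ ())

  last-neighbour : ∀ {w} → P last w → suc (toℕ w) ≡ m
  last-neighbour {w} (inj₁ e) =
    ⊥-elim (ℕ.<-irrefl (trans e (cong suc (toℕ-fromℕ m))) (toℕ<n w))
  last-neighbour (inj₂ e) = trans (sym e) (toℕ-fromℕ m)

  end-neighbour-unique : ∀ {v w w′} → IsEnd v → P v w → P v w′ → w ≡ w′
  end-neighbour-unique (inj₁ refl) adj adj′ =
    toℕ-injective (trans (zero-neighbour adj) (sym (zero-neighbour adj′)))
  end-neighbour-unique (inj₂ refl) adj adj′ =
    toℕ-injective (ℕ.suc-injective (trans (last-neighbour adj) (sym (last-neighbour adj′))))

  end-colorDegreeOne : ∀ {k} (c : Fin n → Fin k) → ¬ m ≡ 0 → ∀ v → IsEnd v → ColorDegreeOne P c v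
  end-colorDegreeOne c m≢0 v end with path-neighbour m≢0 v
  ... | w , adj = c w , λ j → mk⇔
    (λ (w′ , adj′ , cw′) → trans (sym cw′) (cong c (end-neighbour-unique end adj′ adj)))
    (λ j≡ → w , adj , sym j≡)

  rotate-last : ∀ u → rotate (toℕ u) last ≡ prev u
  rotate-last u = trans (rotate-comm u last) (cong (λ s → rotate s u) (toℕ-fromℕ m))

  module _ {k} (c : Fin n → Fin k) (m≢0 : ¬ m ≡ 0) (nl : IsNLColoring C k c) where
    open Subgraph P C path⊆cycle c

    cut-colorDegreeOne-ends : ColorDegreeOne C c Fin.zero → ColorDegreeOne C c last →
      IsNLColoring P k c
    cut-colorDegreeOne-ends cd-zero cd-last = nlColoring-sub nl same
      where
      same : ∀ v → SameNbrColors P C c v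
      same v with classify v
      ... | inj₂ interior     = same-full v (interior-full v interior)
      ... | inj₁ (inj₁ refl) = same-colorDegreeOne v cd-zero (path-neighbour m≢0 v)
      ... | inj₁ (inj₂ refl) = same-colorDegreeOne v cd-last (path-neighbour m≢0 v)

    cut-without-colorDegreeOne : (∀ v → ¬ ColorDegreeOne C c v) → IsNLColoring P k c
    cut-without-colorDegreeOne no-cd1 =
      nlColoring-sub-ends nl no-cd1 IsEnd classify′
        (end-colorDegreeOne c m≢0) ends-adjacent
      where
      classify′ : ∀ v → IsEnd v ⊎ SameNbrColors P C c v
      classify′ v with classify v
      ... | inj₁ end      = inj₁ end
      ... | inj₂ interior = inj₂ (same-full v (interior-full v interior))

  -- Cutting the edge between x and next x, both of colour-degree 1: rotate
  -- so that this edge becomes the closing edge.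
  cut-between : ∀ {k} (c : Fin n → Fin k) → ¬ m ≡ 0 → IsNLColoring C k c →
    (∃ λ x → ColorDegreeOne C c x × ColorDegreeOne C c (next x)) →
    ∃ λ (d : Fin n → Fin k) → IsNLColoring P k d
  cut-between c m≢0 nl (x , cd-x , cd-next) = c ∘ σ , cut-colorDegreeOne-ends (c ∘ σ) m≢0
    (nlColoring-aut α c nl)
    (colorDegreeOne-aut α c Fin.zero (subst (ColorDegreeOne C c) (sym (rotate-zero (next x))) cd-next))
    (colorDegreeOne-aut α c last
      (subst (ColorDegreeOne C c) (sym (trans (rotate-last (next x)) (prev-next x))) cd-x))
    where
    α : Automorphism C
    α = rotation (next x)
    open Automorphism α using (σ)

-- Lemma 14: a 1-paired k-NL-colouring of C_n yields a k-NL-colouring of P_n.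

lemma14 : (k n : ℕ) → k ≥ 4 → n ≥ 3 →
    (∃ λ (c : Fin n → Fin k) → IsNLColoring (CycleAdj n) k c × IsOnePaired (CycleAdj n) c) →
    ∃ λ (c : Fin n → Fin k) → IsNLColoring (PathAdj n) k c
lemma14 k (suc (suc (suc m))) _ (s≤s (s≤s (s≤s z≤n))) (c , nl , paired)
  with any? (Path.colorDegreeOne? (suc (suc m)) c)
... | no none = c , cut-without-colorDegreeOne c (λ ()) nl λ v cd → none (v , cd)
  where open Path (suc (suc m))
... | yes (a , cd-a) = cut-between c (λ ()) nl (paired-edge c paired a cd-a)
  where open Path (suc (suc m))
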